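{- Let $\mathcal{H}$ be a hypergraph, $S,B \subseteq V(\mathcal{H})$ and $x \in S$. Let $\mathcal{H}_1 := \mathcal{H} \setminus \mathcal{H}(x)$ and $\mathcal{H}_2 := \mathcal{H} \setminus (\mathcal{H}(B) \cap \mathcal{H}(x))$. Then \[ \big(\{\{x\}\} \otimes \mathsf{btr}_{B}(\mathcal{H}_1,S\setminus\{x\})\big) \setminus \mathsf{btr}_{B}(\mathcal{H},S)(x) = \{\{x\}\} \otimes \mathsf{btr}_{B \cup \{x\}}(\mathcal{H}_2,S\setminus\{x\}). \]
   Context: A hypergraph $\mathcal{H}$ is a finite collection of subsets (hyperedges) of a finite ground set; $V(\mathcal{H})=\bigcup_{e\in\mathcal{H}} e$. Any subset of $\mathcal{H}$ is a sub-hypergraph. For $S\subseteq V(\mathcal{H})$, $\mathcal{H}(S)=\{e\in\mathcal{H}\mid e\cap S\neq\emptyset\}$ and $\mathcal{H}(x)=\mathcal{H}(\{x\})$. A transversal of $\mathcal{H}$ is a set $T\subseteq V(\mathcal{H})$ meeting every hyperedge; $\mathsf{tr}(\mathcal{H})$ is the set of transversals and $\mathsf{mtr}(\mathcal{H})$ the set of inclusion-wise minimal ones ($\mathsf{mtr}(\emptyset)=\{\emptyset\}$). For a sub-hypergraph $\mathcal{H}'\subseteq\mathcal{H}$ and $B\subseteq V(\mathcal{H})$, $\mathsf{btr}_B(\mathcal{H}')=\mathsf{tr}(\mathcal{H}')\cap\mathsf{mtr}(\mathcal{H}'\setminus\mathcal{H}'(B))$ (the $B$-blocked transversals: transversals $T$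 of $\mathcal{H}'$ in which every $x\in T$ has some $e\in\mathcal{H}'\setminus\mathcal{H}'(B)$ with $e\cap T=\{x\}$). For $S\subseteq V(\mathcal{H})$, $\mathsf{btr}_B(\mathcal{H}',S)=\{T\in\mathsf{btr}_B(\mathcal{H}')\mid T\subseteq S\}$, and $\mathsf{btr}_B(\mathcal{H}',S)(x)=\{T\in\mathsf{btr}_B(\mathcal{H}',S)\mid x\in T\}$. For families $\mathcal{A}_1,\mathcal{A}_2$ of sets, $\mathcal{A}_1\otimes\mathcal{A}_2$ is $\emptyset$ if one of them is empty and $\{T_1\cup T_2\mid T_1\in\mathcal{A}_1,T_2\in\mathcal{A}_2\}$ otherwise. -}

module Defs where

open import Data.Nat using (ℕ)
open import Data.Fin using (Fin)
open import Data.Fin.Subset using (Subset; _∈_; _⊆_; _∩_; _∪_; Nonempty)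
open import Data.Fin.Subset.Properties using (nonempty?)
open import Data.List using (List; filter)
import Data.List.Membership.Propositional as LM
open import Data.Product using (Σ; ∃; _×_; _,_)
open import Relation.Nullary using (¬_)
open import Relation.Nullary.Decidable using (_×-dec_; ¬?)
open import Relation.Binary.PropositionalEquality using (_≡_)

Hypergraph : ℕ → Set
Hypergraph n = List (Subset n)

Family : ℕ → Set₁
Family n = Subset n → Set

private variable n : ℕ

Meets : Subset n → Subset n → Set
Meets e X = Nonempty (e ∩ X)

InV : Hypergraph n → Fin n → Set
InV H i = ∃ λ e → (e LM.∈ H) × (i ∈ e)

_⊆V_ : Subset n → Hypergraph n → Set
X ⊆V H = ∀ i → i ∈ X → InV H i

_∖H[_] : Hypergraph n → Subset n → Hypergraph n
H ∖H[ X ] = filter (λ e → ¬? (nonempty? (e ∩ X))) H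

_∖H[_]∩H[_] : Hypergraph n → Subset n → Subset n → Hypergraph n
H ∖H[ X ]∩H[ Y ] = filter (λ e → ¬? (nonempty? (e ∩ X) ×-dec nonempty? (e ∩ Y))) H

Tr : Hypergraph n → Family n
Tr H T = (T ⊆V H) × (∀ e → e LM.∈ H → Meets e T)

Mtr : Hypergraph n → Family n
Mtr H T = Tr H T × (∀ T' → T' ⊆ T → Tr H T' → T' ≡ T)

Btr : Subset n → Hypergraph n → Family n
Btr B H T = Tr H T × Mtr (H ∖H[ B ]) T

BtrS : Subset n → Hypergraph n → Subset n → Family n
BtrS B H S T = Btr B H T × T ⊆ S

BtrSx : Subset n → Hypergraph n → Subset n → Fin n → Family n
BtrSx B H S x T = BtrS B H S T × x ∈ T

_⊗_ : Family n → Family n → Family n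
(A₁ ⊗ A₂) T = ∃ λ T₁ → ∃ λ T₂ → A₁ T₁ × A₂ T₂ × T ≡ T₁ ∪ T₂

_∖F_ : Family n → Family n → Family n
(A ∖F C) T = A T × ¬ C T

｛_｝ : Subset n → Family n
｛ X ｝ T = T ≡ X

_≐_ : Family n → Family n → Set
A ≐ C = ∀ T → (A T → C T) × (C T → A T)

{-# OPTIONS --safe #-}
-- The hypergraphs H₁ ∖ H₁(B) and
-- H₂ ∖ H₂(B ∪ {x}) have the same edges (those avoiding both B and x), so the minimality
-- conditions on both sides agree, and H₂ is H₁ plus the edges through x that avoid B.
-- For T ∈ btr_B(H₁), the set {x} ∪ T is B-blocked in H exactly when x has a private
-- edge, i.e. some edge through x avoids both B and T. So {x} ∪ T is not blocked iff
-- T meets every edge through x avoiding B, i.e. iff T is a transversal of H₂.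
module Submission where

open import Defs
open import Data.Nat using (ℕ)
open import Data.Fin using (Fin)
open import Data.Fin.Subset using (Subset; _∈_; _∉_; _∪_; _∩_; ⁅_⁆; _-_; _─_; _⊆_; inside; outside)
open import Data.Fin.Subset.Properties
  using (_∈?_; nonempty?; x∈⁅x⁆; x∈⁅y⁆⇒x≡y; x∈p∩q⁺; x∈p∩q⁻; x∈p∪q⁻; p⊆p∪q; q⊆p∪q; p─q⊆p; x∈p∧x≢y⇒x∈p-y; ⊆-antisym)
open import Data.List.Membership.Propositional using () renaming (_∈_ to _∈ᴴ_)
open import Data.List.Membership.Propositional.Properties using (∈-filter⁺; ∈-filter⁻)
open import Data.List.Relation.Binary.Subset.Propositional using () renaming (_⊆_ to _⊑_)
open import Data.Product using (Σ; _×_; _,_; proj₁; proj₂)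
open import Data.Sum using (_⊎_; inj₁; inj₂)
open import Data.Empty using (⊥-elim)
open import Function using (_∘_; case_of_)
open import Data.Vec.Base using (_∷_; here; there)
open import Relation.Nullary using (¬_; yes; no)
open import Relation.Nullary.Decidable using (_×-dec_; ¬?)
open import Relation.Binary.PropositionalEquality using (_≡_; refl; sym; subst)

private variable
  n : ℕ
  x j : Fin n
  e X Y S T U : Subset n
  H L L' : Hypergraph n

x∈p─q⇒x∉q : (p q : Subset n) → x ∈ p ─ q → x ∉ q
x∈p─q⇒x∉q (inside ∷ p) (outside ∷ q) here ()
x∈p─q⇒x∉q (_ ∷ p) (_ ∷ q) (there x∈p─q) (there x∈q) = x∈p─q⇒x∉q p q x∈p─q x∈q

∈-⁅⁆∪⁻ : j ∈ ⁅ x ⁆ ∪ T → j ≡ x ⊎ j ∈ T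
∈-⁅⁆∪⁻ {x = x} {T = T} j∈ with x∈p∪q⁻ ⁅ x ⁆ T j∈
... | inj₁ j∈⁅x⁆ = inj₁ (x∈⁅y⁆⇒x≡y x j∈⁅x⁆)
... | inj₂ j∈T   = inj₂ j∈T

⁅⁆∪⊆ : x ∈ S → T ⊆ S - x → ⁅ x ⁆ ∪ T ⊆ S
⁅⁆∪⊆ {x = x} {S = S} x∈S T⊆S-x j∈ with ∈-⁅⁆∪⁻ j∈
... | inj₁ refl = x∈S
... | inj₂ j∈T  = p─q⊆p S ⁅ x ⁆ (T⊆S-x j∈T)

meets⁺ : j ∈ e → j ∈ X → Meets e X
meets⁺ {j = j} j∈e j∈X = j , x∈p∩q⁺ (j∈e , j∈X)

meets⁻ : Meets e X → Σ (Fin n) λ j → j ∈ e × j ∈ X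
meets⁻ {e = e} {X = X} (j , j∈e∩X) = j , x∈p∩q⁻ e X j∈e∩X

meets-mono : X ⊆ Y → Meets e X → Meets e Y
meets-mono X⊆Y e∩X with meets⁻ e∩X
... | j , j∈e , j∈X = meets⁺ j∈e (X⊆Y j∈X)

meets-∪⁻ : Meets e (X ∪ Y) → Meets e X ⊎ Meets e Y
meets-∪⁻ {X = X} {Y = Y} e∩X∪Y with meets⁻ e∩X∪Y
... | j , j∈e , j∈X∪Y with x∈p∪q⁻ X Y j∈X∪Y
... | inj₁ j∈X = inj₁ (meets⁺ j∈e j∈X)
... | inj₂ j∈Y = inj₂ (meets⁺ j∈e j∈Y)

meets-⁅⁆⁺ : x ∈ e → Meets e ⁅ x ⁆
meets-⁅⁆⁺ {x = x} x∈e = meets⁺ x∈e (x∈⁅x⁆ x)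

meets-⁅⁆⁻ : Meets e ⁅ x ⁆ → x ∈ e
meets-⁅⁆⁻ {e = e} {x = x} e∩⁅x⁆ with meets⁻ e∩⁅x⁆
... | j , j∈e , j∈⁅x⁆ = subst (_∈ e) (x∈⁅y⁆⇒x≡y x j∈⁅x⁆) j∈e

∈-∖H⁺ : (X : Subset n) → e ∈ᴴ H → ¬ Meets e X → e ∈ᴴ H ∖H[ X ]
∈-∖H⁺ X = ∈-filter⁺ (λ e → ¬? (nonempty? (e ∩ X)))

∈-∖H⁻ : (H : Hypergraph n) (X : Subset n) → e ∈ᴴ H ∖H[ X ] → e ∈ᴴ H × ¬ Meets e X
∈-∖H⁻ H X = ∈-filter⁻ (λ e → ¬? (nonempty? (e ∩ X)))

∈-∖H∩H⁺ : (Y X : Subset n) → e ∈ᴴ H → ¬ (Meets e Y × Meets e X) → e ∈ᴴ H ∖H[ Y ]∩H[ X ]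
∈-∖H∩H⁺ Y X = ∈-filter⁺ (λ e → ¬? (nonempty? (e ∩ Y) ×-dec nonempty? (e ∩ X)))

∈-∖H∩H⁻ : (H : Hypergraph n) (Y X : Subset n) → e ∈ᴴ H ∖H[ Y ]∩H[ X ] → e ∈ᴴ H × ¬ (Meets e Y × Meets e X)
∈-∖H∩H⁻ H Y X = ∈-filter⁻ (λ e → ¬? (nonempty? (e ∩ Y) ×-dec nonempty? (e ∩ X)))

infix 4 _≋_

_≋_ : Hypergraph n → Hypergraph n → Set
L ≋ L' = L ⊑ L' × L' ⊑ L

≋-sym : L ≋ L' → L' ≋ L
≋-sym (L⊑L' , L'⊑L) = L'⊑L , L⊑L'

∖H⊑ : (H : Hypergraph n) (X : Subset n) → H ∖H[ X ] ⊑ H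
∖H⊑ H X e∈ = proj₁ (∈-∖H⁻ H X e∈)

∖H⊑∖H∩H : (H : Hypergraph n) (Y X : Subset n) → H ∖H[ X ] ⊑ H ∖H[ Y ]∩H[ X ]
∖H⊑∖H∩H H Y X e∈ with ∈-∖H⁻ H X e∈
... | e∈H , ¬X = ∈-∖H∩H⁺ Y X e∈H (λ (_ , X) → ¬X X)

∖H-∖H⊑ : (H : Hypergraph n) (X Y : Subset n) → (H ∖H[ X ]) ∖H[ Y ] ⊑ (H ∖H[ Y ]) ∖H[ X ]
∖H-∖H⊑ H X Y e∈ with ∈-∖H⁻ (H ∖H[ X ]) Y e∈
... | e∈H∖X , ¬Y with ∈-∖H⁻ H X e∈H∖X
... | e∈H , ¬X = ∈-∖H⁺ X (∈-∖H⁺ Y e∈H ¬Y) ¬X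

∖H-comm : (H : Hypergraph n) (X Y : Subset n) → (H ∖H[ X ]) ∖H[ Y ] ≋ (H ∖H[ Y ]) ∖H[ X ]
∖H-comm H X Y = ∖H-∖H⊑ H X Y , ∖H-∖H⊑ H Y X

∖H∩H-∖H : (H : Hypergraph n) (Y X : Subset n) → (H ∖H[ Y ]∩H[ X ]) ∖H[ X ] ≋ H ∖H[ X ]
∖H∩H-∖H H Y X = to , from
  where
  to : (H ∖H[ Y ]∩H[ X ]) ∖H[ X ] ⊑ H ∖H[ X ]
  to e∈ with ∈-∖H⁻ (H ∖H[ Y ]∩H[ X ]) X e∈
  ... | e∈H₂ , ¬X = ∈-∖H⁺ X (proj₁ (∈-∖H∩H⁻ H Y X e∈H₂)) ¬X
  from : H ∖H[ X ] ⊑ (H ∖H[ Y ]∩H[ X ]) ∖H[ X ]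
  from e∈ = ∈-∖H⁺ X (∖H⊑∖H∩H H Y X e∈) (proj₂ (∈-∖H⁻ H X e∈))

∖H-∖H≋∖H∩H-∖H∪ : (H : Hypergraph n) (X Y : Subset n) → (H ∖H[ X ]) ∖H[ Y ] ≋ (H ∖H[ Y ]∩H[ X ]) ∖H[ Y ∪ X ]
∖H-∖H≋∖H∩H-∖H∪ H X Y = to , from
  where
  to : (H ∖H[ X ]) ∖H[ Y ] ⊑ (H ∖H[ Y ]∩H[ X ]) ∖H[ Y ∪ X ]
  to e∈ with ∈-∖H⁻ (H ∖H[ X ]) Y e∈
  ... | e∈H∖X , ¬Y with ∈-∖H⁻ H X e∈H∖X
  ... | e∈H , ¬X = ∈-∖H⁺ (Y ∪ X) (∈-∖H∩H⁺ Y X e∈H (λ (Y , _) → ¬Y Y)) λ Y∪X →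
    case meets-∪⁻ Y∪X of λ { (inj₁ Y) → ¬Y Y ; (inj₂ X) → ¬X X }
  from : (H ∖H[ Y ]∩H[ X ]) ∖H[ Y ∪ X ] ⊑ (H ∖H[ X ]) ∖H[ Y ]
  from e∈ with ∈-∖H⁻ (H ∖H[ Y ]∩H[ X ]) (Y ∪ X) e∈
  ... | e∈H₂ , ¬Y∪X =
    ∈-∖H⁺ Y (∈-∖H⁺ X (proj₁ (∈-∖H∩H⁻ H Y X e∈H₂)) (¬Y∪X ∘ meets-mono (q⊆p∪q Y X)))
            (¬Y∪X ∘ meets-mono (p⊆p∪q X))

⊆V-mono : L ⊑ L' → T ⊆V L → T ⊆V L'
⊆V-mono L⊑L' T⊆V i i∈T with T⊆V i i∈T
... | e , e∈L , i∈e = e , L⊑L' e∈L , i∈e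

Tr-antimono : L ⊑ L' → T ⊆V L → Tr L' T → Tr L T
Tr-antimono L⊑L' T⊆V (_ , hits) = T⊆V , λ e e∈L → hits e (L⊑L' e∈L)

Tr-cong : L ≋ L' → Tr L T → Tr L' T
Tr-cong (L⊑L' , L'⊑L) tr@(T⊆V , _) = Tr-antimono L'⊑L (⊆V-mono L⊑L' T⊆V) tr

Mtr-cong : L ≋ L' → Mtr L T → Mtr L' T
Mtr-cong L≋L' (tr , minimal) =
  Tr-cong L≋L' tr , λ T' T'⊆T tr' → minimal T' T'⊆T (Tr-cong (≋-sym L≋L') tr')

hits-split : (L : Hypergraph n) (x : Fin n) →
  (∀ e → e ∈ᴴ L ∖H[ ⁅ x ⁆ ] → Meets e T) → (∀ e → e ∈ᴴ L → x ∈ e → Meets e T) →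
  ∀ e → e ∈ᴴ L → Meets e T
hits-split L x hits hits-x e e∈L with x ∈? e
... | yes x∈e = hits-x e e∈L x∈e
... | no  x∉e = hits e (∈-∖H⁺ ⁅ x ⁆ e∈L (x∉e ∘ meets-⁅⁆⁻))

Tr-split : (L : Hypergraph n) (x : Fin n) →
  Tr (L ∖H[ ⁅ x ⁆ ]) T → (∀ e → e ∈ᴴ L → x ∈ e → Meets e T) → Tr L T
Tr-split L x (T⊆V , hits) hits-x = ⊆V-mono (∖H⊑ L ⁅ x ⁆) T⊆V , hits-split L x hits hits-x

Tr-insert : (L : Hypergraph n) (x : Fin n) →
  Tr (L ∖H[ ⁅ x ⁆ ]) T → e ∈ᴴ L → x ∈ e → Tr L (⁅ x ⁆ ∪ T)
Tr-insert {T = T} {e = e} L x (T⊆V , hits) e∈L x∈e = U⊆V , hits-split L x hits-T hits-x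
  where
  U⊆V : (⁅ x ⁆ ∪ T) ⊆V L
  U⊆V i i∈U with ∈-⁅⁆∪⁻ i∈U
  ... | inj₁ refl = e , e∈L , x∈e
  ... | inj₂ i∈T  = ⊆V-mono (∖H⊑ L ⁅ x ⁆) T⊆V i i∈T
  hits-T : ∀ e' → e' ∈ᴴ L ∖H[ ⁅ x ⁆ ] → Meets e' (⁅ x ⁆ ∪ T)
  hits-T e' e'∈ = meets-mono (q⊆p∪q ⁅ x ⁆ T) (hits e' e'∈)
  hits-x : ∀ e' → e' ∈ᴴ L → x ∈ e' → Meets e' (⁅ x ⁆ ∪ T)
  hits-x e' _ x∈e' = meets⁺ x∈e' (p⊆p∪q T (x∈⁅x⁆ x))

-- A transversal T' ⊆ ⁅ x ⁆ ∪ T of L still meets every edge avoiding x after x is removed,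
-- so T' - x = T by minimality; and e, which T misses, forces x ∈ T'.
Mtr-insert : (L : Hypergraph n) (x : Fin n) →
  Mtr (L ∖H[ ⁅ x ⁆ ]) T → e ∈ᴴ L → x ∈ e → ¬ Meets e T → Mtr L (⁅ x ⁆ ∪ T)
Mtr-insert {T = T} {e = e} L x (tr , minimal) e∈L x∈e ¬e∩T =
  Tr-insert L x tr e∈L x∈e , λ T' T'⊆U tr' → ⊆-antisym T'⊆U (U⊆ T' T'⊆U tr')
  where
  U⊆ : ∀ T' → T' ⊆ ⁅ x ⁆ ∪ T → Tr L T' → ⁅ x ⁆ ∪ T ⊆ T'
  U⊆ T' T'⊆U (T'⊆V , T'hits) {i} i∈U with ∈-⁅⁆∪⁻ i∈U
  ... | inj₂ i∈T  = p─q⊆p T' ⁅ x ⁆ (subst (i ∈_) (sym T'-x≡T) i∈T)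
    where
    T'-x⊆T : T' - x ⊆ T
    T'-x⊆T j∈ with ∈-⁅⁆∪⁻ (T'⊆U (p─q⊆p T' ⁅ x ⁆ j∈))
    ... | inj₁ refl = ⊥-elim (x∈p─q⇒x∉q T' ⁅ x ⁆ j∈ (x∈⁅x⁆ x))
    ... | inj₂ j∈T  = j∈T
    hits : ∀ e' → e' ∈ᴴ L ∖H[ ⁅ x ⁆ ] → Meets e' (T' - x)
    hits e' e'∈ with meets⁻ (T'hits e' (∖H⊑ L ⁅ x ⁆ e'∈))
    ... | j , j∈e' , j∈T' = meets⁺ j∈e' (x∈p∧x≢y⇒x∈p-y j∈T' λ { refl →
      proj₂ (∈-∖H⁻ L ⁅ x ⁆ e'∈) (meets-⁅⁆⁺ j∈e') })
    T'-x≡T : T' - x ≡ T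
    T'-x≡T = minimal (T' - x) T'-x⊆T ((λ j j∈ → proj₁ tr j (T'-x⊆T j∈)) , hits)
  ... | inj₁ refl with meets⁻ (T'hits e e∈L)
  ...   | j , j∈e , j∈T' with ∈-⁅⁆∪⁻ (T'⊆U j∈T')
  ...     | inj₁ refl = j∈T'
  ...     | inj₂ j∈T  = ⊥-elim (¬e∩T (meets⁺ j∈e j∈T))

Mtr⇒¬Tr-⊂ : Mtr L U → T ⊆ U → x ∈ U → x ∉ T → ¬ Tr L T
Mtr⇒¬Tr-⊂ {x = x} (_ , minimal) T⊆U x∈U x∉T trT =
  x∉T (subst (x ∈_) (sym (minimal _ T⊆U trT)) x∈U)

module _ (H : Hypergraph n) (B : Subset n) (x : Fin n) where

  private
    H₁ H₂ : Hypergraph n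
    H₁ = H ∖H[ ⁅ x ⁆ ]
    H₂ = H ∖H[ B ]∩H[ ⁅ x ⁆ ]

  Btr-insert : Btr B H₁ T → e ∈ᴴ H → x ∈ e → ¬ Meets e B → ¬ Meets e T → Btr B H (⁅ x ⁆ ∪ T)
  Btr-insert (tr₁ , mtr₁) e∈H x∈e ¬e∩B ¬e∩T =
    Tr-insert H x tr₁ e∈H x∈e ,
    Mtr-insert (H ∖H[ B ]) x (Mtr-cong (∖H-comm H ⁅ x ⁆ B) mtr₁) (∈-∖H⁺ B e∈H ¬e∩B) x∈e ¬e∩T

  BtrS₁-unblocked⇒BtrS₂ : x ∈ S → BtrS B H₁ (S - x) T → ¬ BtrSx B H S x (⁅ x ⁆ ∪ T) →
                          BtrS (B ∪ ⁅ x ⁆) H₂ (S - x) T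
  BtrS₁-unblocked⇒BtrS₂ {T = T} x∈S (btr₁@(tr₁ , mtr₁) , T⊆S-x) unblocked =
    (Tr-split H₂ x (Tr-cong (≋-sym (∖H∩H-∖H H B ⁅ x ⁆)) tr₁) hits-x ,
     Mtr-cong (∖H-∖H≋∖H∩H-∖H∪ H ⁅ x ⁆ B) mtr₁) ,
    T⊆S-x
    where
    hits-x : ∀ e → e ∈ᴴ H₂ → x ∈ e → Meets e T
    hits-x e e∈H₂ x∈e with nonempty? (e ∩ T) | ∈-∖H∩H⁻ H B ⁅ x ⁆ e∈H₂
    ... | yes e∩T | _            = e∩T
    ... | no ¬e∩T | e∈H , ¬both = ⊥-elim (unblocked (
      (Btr-insert btr₁ e∈H x∈e (λ e∩B → ¬both (e∩B , meets-⁅⁆⁺ x∈e)) ¬e∩T , ⁅⁆∪⊆ x∈S T⊆S-x) ,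
      p⊆p∪q T (x∈⁅x⁆ x)))

  BtrS₂⇒BtrS₁ : BtrS (B ∪ ⁅ x ⁆) H₂ (S - x) T → BtrS B H₁ (S - x) T
  BtrS₂⇒BtrS₁ {T = T} ((tr₂ , mtr₂) , T⊆S-x) = (tr₁ , mtr₁) , T⊆S-x
    where
    mtr₁ : Mtr (H₁ ∖H[ B ]) T
    mtr₁ = Mtr-cong (≋-sym (∖H-∖H≋∖H∩H-∖H∪ H ⁅ x ⁆ B)) mtr₂
    tr₁ : Tr H₁ T
    tr₁ = Tr-antimono (∖H⊑∖H∩H H B ⁅ x ⁆) (⊆V-mono (∖H⊑ H₁ B) (proj₁ (proj₁ mtr₁))) tr₂

  -- x is redundant in ⁅ x ⁆ ∪ T, since T already hits every edge of H ∖ H(B) through x.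
  BtrS₂⇒unblocked : BtrS (B ∪ ⁅ x ⁆) H₂ (S - x) T → ¬ BtrSx B H S x (⁅ x ⁆ ∪ T)
  BtrS₂⇒unblocked {S = S} {T = T} ((tr₂ , mtr₂) , T⊆S-x) (((_ , mtrU) , _) , x∈U) =
    Mtr⇒¬Tr-⊂ mtrU (q⊆p∪q ⁅ x ⁆ T) x∈U x∉T trK
    where
    x∉T : x ∉ T
    x∉T x∈T = x∈p─q⇒x∉q S ⁅ x ⁆ (T⊆S-x x∈T) (x∈⁅x⁆ x)
    hits-x : ∀ e → e ∈ᴴ H ∖H[ B ] → x ∈ e → Meets e T
    hits-x e e∈K _ with ∈-∖H⁻ H B e∈K
    ... | e∈H , ¬e∩B = proj₂ tr₂ e (∈-∖H∩H⁺ B ⁅ x ⁆ e∈H (λ (e∩B , _) → ¬e∩B e∩B))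
    tr₁ : Tr (H₁ ∖H[ B ]) T
    tr₁ = proj₁ (Mtr-cong (≋-sym (∖H-∖H≋∖H∩H-∖H∪ H ⁅ x ⁆ B)) mtr₂)
    trK : Tr (H ∖H[ B ]) T
    trK = Tr-split (H ∖H[ B ]) x (Tr-cong (∖H-comm H ⁅ x ⁆ B) tr₁) hits-x

lemma3 : (n : ℕ) (H : Hypergraph n) (S B : Subset n) (x : Fin n) →
    S ⊆V H → B ⊆V H → x ∈ S →
    ((｛ ⁅ x ⁆ ｝ ⊗ BtrS B (H ∖H[ ⁅ x ⁆ ]) (S - x)) ∖F BtrSx B H S x)
      ≐ (｛ ⁅ x ⁆ ｝ ⊗ BtrS (B ∪ ⁅ x ⁆) (H ∖H[ B ]∩H[ ⁅ x ⁆ ]) (S - x))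
lemma3 n H S B x _ _ x∈S T =
  (λ { ((_ , T₂ , refl , btr₁ , T≡) , unblocked) →
         _ , T₂ , refl ,
         BtrS₁-unblocked⇒BtrS₂ H B x x∈S btr₁ (unblocked ∘ subst (BtrSx B H S x) (sym T≡)) , T≡ }) ,
  (λ { (_ , T₂ , refl , btr₂ , T≡) →
         (_ , T₂ , refl , BtrS₂⇒BtrS₁ H B x btr₂ , T≡) ,
         BtrS₂⇒unblocked H B x btr₂ ∘ subst (BtrSx B H S x) T≡ })
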